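{- For integers $m\ge 2$ and $p\ge 0$ define \[ a_{m,p}:=\sum_{\substack{k_2,\dots,k_m\ge 0\\ k_2+\cdots+k_m=p}}\frac{(k_2+\cdots+k_m+m-1)!}{(k_2+1)!\cdots(k_m+1)!}. \] Then for fixed $m\ge 2$ and $p\ge 0$, \[ \sum_{t=0}^{m-2}\binom{m-1}{t}a_{m-t,\,p+t}=(m-1)^{m+p-1}. \] -}

module Defs where

open import Data.Nat using (ℕ; zero; suc; _∸_; _!; NonZero)
import Data.Nat as ℕ
open import Data.Nat.Properties using (_!≢0; m*n≢0)
open import Data.Integer using (+_)
open import Data.List using (List; []; _∷_; map; concatMap; upTo)
open import Data.Vec using (Vec; []; _∷_)
import Data.Vec as Vec
open import Data.Rational using (ℚ; _/_; _+_; _*_; 0ℚ)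

compositions : (n p : ℕ) → List (Vec ℕ n)
compositions zero zero = [] ∷ []
compositions zero (suc p) = []
compositions (suc n) p =
  concatMap (λ k → map (k ∷_) (compositions n (p ∸ k))) (upTo (suc p))

factProd : {n : ℕ} → Vec ℕ n → ℕ
factProd [] = 1
factProd (k ∷ ks) = (suc k) ! ℕ.* factProd ks

factProd≢0 : {n : ℕ} (ks : Vec ℕ n) → NonZero (factProd ks)
factProd≢0 [] = _
factProd≢0 (k ∷ ks) = m*n≢0 ((suc k) !) (factProd ks) {{suc k !≢0}} {{factProd≢0 ks}}

-- The summand (k₂+⋯+k_m+m-1)! / ((k₂+1)!⋯(k_m+1)!) for a vector
-- ks = (k₂,…,k_m) with n = m-1 entries, as a rational number.
term : {n : ℕ} → Vec ℕ n → ℚ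
term {n} ks = (+ ((Vec.sum ks ℕ.+ n) !)) / factProd ks
  where instance _ = factProd≢0 ks

sumℚ : List ℚ → ℚ
sumℚ [] = 0ℚ
sumℚ (x ∷ xs) = x + sumℚ xs

a : (m p : ℕ) → ℚ
a m p = sumℚ (map term (compositions (m ∸ 1) p))

module Submission where

-- Write n = m - 1.  We read the paper's identity as a count of maps between finite sets.
--
-- * surj j N, defined by the recursion "choose which r < N points miss the first target
--   point, then map them onto the remaining j - 1", counts surjections from an N-set onto
--   a j-set.  Grouping the maps N → n by their image gives Σ_j C(n,j) surj j N = n^N
--   (surj-total); this is proved by induction on n using Pascal's rule for binomial sums
--   and the binomial theorem, both developed for arbitrary f in Σ_j C(n,j) f(j).
-- * The summand (k₂+⋯+k_m+m-1)!/∏(kᵢ+1)! is the number of surjections whose fibres have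
--   sizes k₂+1, …, k_m+1, so a_{n+1,p} = surj n (n+p) (a-counts-surjections); in Agda this
--   is an induction over the list of compositions, splitting off the first part.
-- * The theorem is then Σ_{t<n} C(n,t) surj (n-t) (n+p) = n^{n+p}: the total count with the
--   empty image (t = n) dropped, which contributes nothing since n + p ≥ 1.

module Counting where
  open import Data.Nat
  open import Data.Nat.Properties
  open import Data.Nat.Combinatorics using (_C_; nCk+nC[k+1]≡[n+1]C[k+1]; nCk≡nC[n∸k]; nCn≡1; k>n⇒nCk≡0)
  open import Algebra.Properties.CommutativeSemigroup +-commutativeSemigroup using () renaming (interchange to +-interchange)
  open import Algebra.Properties.CommutativeSemigroup *-commutativeSemigroup using () renaming (x∙yz≈y∙xz to *-leftComm)
  open import Relation.Binary.PropositionalEquality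
  open ≡-Reasoning

  Σ : ℕ → (ℕ → ℕ) → ℕ
  Σ zero    f = 0
  Σ (suc n) f = f 0 + Σ n (λ i → f (suc i))

  Σ-cong : ∀ n {f g : ℕ → ℕ} → (∀ i → i < n → f i ≡ g i) → Σ n f ≡ Σ n g
  Σ-cong zero    eq = refl
  Σ-cong (suc n) eq = cong₂ _+_ (eq 0 z<s) (Σ-cong n (λ i i<n → eq (suc i) (s<s i<n)))

  Σ-zero : ∀ n (f : ℕ → ℕ) → (∀ i → i < n → f i ≡ 0) → Σ n f ≡ 0
  Σ-zero zero    f eq = refl
  Σ-zero (suc n) f eq = cong₂ _+_ (eq 0 z<s) (Σ-zero n _ (λ i i<n → eq (suc i) (s<s i<n)))

  Σ-last : ∀ n (f : ℕ → ℕ) → Σ (suc n) f ≡ Σ n f + f n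
  Σ-last zero    f = +-comm (f 0) 0
  Σ-last (suc n) f = trans (cong (f 0 +_) (Σ-last n (λ i → f (suc i)))) (sym (+-assoc (f 0) _ _))

  Σ-split : ∀ a b (f : ℕ → ℕ) → Σ (a + b) f ≡ Σ a f + Σ b (λ i → f (a + i))
  Σ-split zero    b f = refl
  Σ-split (suc a) b f = trans (cong (f 0 +_) (Σ-split a b (λ i → f (suc i)))) (sym (+-assoc (f 0) _ _))

  Σ-rev : ∀ n (f : ℕ → ℕ) → Σ n f ≡ Σ n (λ i → f (n ∸ suc i))
  Σ-rev zero    f = refl
  Σ-rev (suc n) f = begin
    f 0 + Σ n (λ i → f (suc i))                 ≡⟨ cong (f 0 +_) (Σ-rev n (λ i → f (suc i))) ⟩
    f 0 + Σ n (λ i → f (suc (n ∸ suc i)))       ≡⟨ cong (f 0 +_) (Σ-cong n (λ i i<n → cong f (sym (+-∸-assoc 1 i<n)))) ⟩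
    f 0 + Σ n (λ i → f (n ∸ i))                 ≡⟨ +-comm (f 0) _ ⟩
    Σ n (λ i → f (n ∸ i)) + f 0                 ≡⟨ cong (λ z → Σ n (λ i → f (n ∸ i)) + f z) (sym (n∸n≡0 n)) ⟩
    Σ n (λ i → f (n ∸ i)) + f (n ∸ n)           ≡⟨ sym (Σ-last n (λ i → f (n ∸ i))) ⟩
    Σ (suc n) (λ i → f (n ∸ i))                 ∎

  Σ-+ : ∀ n (f g : ℕ → ℕ) → Σ n (λ i → f i + g i) ≡ Σ n f + Σ n g
  Σ-+ zero    f g = refl
  Σ-+ (suc n) f g = trans (cong (f 0 + g 0 +_) (Σ-+ n (λ i → f (suc i)) (λ i → g (suc i))))
                          (+-interchange (f 0) (g 0) _ _)

  Σ-*ˡ : ∀ n c (f : ℕ → ℕ) → Σ n (λ i → c * f i) ≡ c * Σ n f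
  Σ-*ˡ zero    c f = sym (*-zeroʳ c)
  Σ-*ˡ (suc n) c f = trans (cong (c * f 0 +_) (Σ-*ˡ n c (λ i → f (suc i)))) (sym (*-distribˡ-+ c (f 0) _))

  Σ-swap : ∀ a b (f : ℕ → ℕ → ℕ) → Σ a (λ i → Σ b (f i)) ≡ Σ b (λ j → Σ a (λ i → f i j))
  Σ-swap zero    b f = sym (Σ-zero b _ (λ _ _ → refl))
  Σ-swap (suc a) b f = begin
    Σ b (f 0) + Σ a (λ i → Σ b (f (suc i)))           ≡⟨ cong (Σ b (f 0) +_) (Σ-swap a b (λ i → f (suc i))) ⟩
    Σ b (f 0) + Σ b (λ j → Σ a (λ i → f (suc i) j))   ≡⟨ sym (Σ-+ b _ _) ⟩
    Σ b (λ j → f 0 j + Σ a (λ i → f (suc i) j))       ∎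

  binomSum : ℕ → (ℕ → ℕ) → ℕ
  binomSum n f = Σ (suc n) (λ j → (n C j) * f j)

  binomSum-*ˡ : ∀ n c (f : ℕ → ℕ) → binomSum n (λ j → c * f j) ≡ c * binomSum n f
  binomSum-*ˡ n c f =
    trans (Σ-cong (suc n) (λ j _ → *-leftComm (n C j) c (f j))) (Σ-*ˡ (suc n) c (λ j → (n C j) * f j))

  binomSum-Σ : ∀ n N (h : ℕ → ℕ → ℕ) → binomSum n (λ j → Σ N (h j)) ≡ Σ N (λ r → binomSum n (λ j → h j r))
  binomSum-Σ n N h = begin
    Σ (suc n) (λ j → (n C j) * Σ N (h j))           ≡⟨ Σ-cong (suc n) (λ j _ → sym (Σ-*ˡ N (n C j) (h j))) ⟩
    Σ (suc n) (λ j → Σ N (λ r → (n C j) * h j r))   ≡⟨ Σ-swap (suc n) N (λ j r → (n C j) * h j r) ⟩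
    Σ N (λ r → binomSum n (λ j → h j r))            ∎

  binomSum-pascal : ∀ n (f : ℕ → ℕ) → binomSum (suc n) f ≡ binomSum n f + binomSum n (λ j → f (suc j))
  binomSum-pascal n f = begin
    1 * f 0 + Σ (suc n) (λ j → (suc n C suc j) * f (suc j))  ≡⟨ cong (1 * f 0 +_) split ⟩
    1 * f 0 + (B′ + Σ (suc n) upper)                         ≡⟨ cong (λ z → 1 * f 0 + (B′ + z)) top-vanishes ⟩
    1 * f 0 + (B′ + Σ n upper)                               ≡⟨ cong (1 * f 0 +_) (+-comm B′ _) ⟩
    1 * f 0 + (Σ n upper + B′)                               ≡⟨ sym (+-assoc (1 * f 0) _ B′) ⟩
    binomSum n f + B′                                        ∎
    where
    B′ = binomSum n (λ j → f (suc j))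
    upper : ℕ → ℕ
    upper j = (n C suc j) * f (suc j)
    split : Σ (suc n) (λ j → (suc n C suc j) * f (suc j)) ≡ B′ + Σ (suc n) upper
    split = trans (Σ-cong (suc n) (λ j _ →
                     trans (cong (_* f (suc j)) (sym (nCk+nC[k+1]≡[n+1]C[k+1] n j)))
                           (*-distribʳ-+ (f (suc j)) (n C j) (n C suc j))))
                  (Σ-+ (suc n) (λ j → (n C j) * f (suc j)) upper)
    top-vanishes : Σ (suc n) upper ≡ Σ n upper
    top-vanishes = begin
      Σ (suc n) upper                     ≡⟨ Σ-last n upper ⟩
      Σ n upper + (n C suc n) * f (suc n) ≡⟨ cong (λ c → Σ n upper + c * f (suc n)) (k>n⇒nCk≡0 (n<1+n n)) ⟩
      Σ n upper + 0                       ≡⟨ +-identityʳ _ ⟩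
      Σ n upper                           ∎

  binomSum-reflect : ∀ n (f : ℕ → ℕ) → Σ (suc n) (λ t → (n C t) * f (n ∸ t)) ≡ binomSum n f
  binomSum-reflect n f = trans (Σ-rev (suc n) (λ t → (n C t) * f (n ∸ t))) (Σ-cong (suc n) symmetric)
    where
    symmetric : ∀ j → j < suc n → (n C (n ∸ j)) * f (n ∸ (n ∸ j)) ≡ (n C j) * f j
    symmetric j j<1+n = cong₂ (λ c i → c * f i) (sym (nCk≡nC[n∸k] j≤n)) (m∸[m∸n]≡n j≤n)
      where j≤n = ≤-pred j<1+n

  binomial-theorem : ∀ x N → binomSum N (x ^_) ≡ suc x ^ N
  binomial-theorem x zero    = refl
  binomial-theorem x (suc N) = begin
    binomSum (suc N) (x ^_)                               ≡⟨ binomSum-pascal N (x ^_) ⟩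
    binomSum N (x ^_) + binomSum N (λ r → x * x ^ r)      ≡⟨ cong (binomSum N (x ^_) +_) (binomSum-*ˡ N x (x ^_)) ⟩
    suc x * binomSum N (x ^_)                             ≡⟨ cong (suc x *_) (binomial-theorem x N) ⟩
    suc x ^ suc N                                         ∎

  -- surj j N is the number of surjections from an N-set onto a j-set: the r points not
  -- sent to the first target form a proper subset (r < N), mapped onto the other j - 1.
  surj : ℕ → ℕ → ℕ
  surj zero    zero    = 1
  surj zero    (suc N) = 0
  surj (suc j) N       = Σ N (λ r → (N C r) * surj j r)

  surj-vanish : ∀ j N → N < j → surj j N ≡ 0
  surj-vanish (suc j) N (s≤s N≤j) = Σ-zero N _ (λ r r<N →
    trans (cong ((N C r) *_) (surj-vanish j r (<-≤-trans r<N N≤j))) (*-zeroʳ (N C r)))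

  -- Every map N → n is a surjection onto its image:  Σ_j C(n,j) surj j N = n^N.
  surj-total : ∀ n N → binomSum n (λ j → surj j N) ≡ n ^ N
  surj-total zero    zero    = refl
  surj-total zero    (suc N) = refl
  surj-total (suc n) N = begin
    binomSum (suc n) (λ j → surj j N)
      ≡⟨ binomSum-pascal n (λ j → surj j N) ⟩
    binomSum n (λ j → surj j N) + binomSum n (λ j → surj (suc j) N)
      ≡⟨ cong₂ _+_ (surj-total n N) (binomSum-Σ n N (λ j r → (N C r) * surj j r)) ⟩
    n ^ N + Σ N (λ r → binomSum n (λ j → (N C r) * surj j r))
      ≡⟨ cong (n ^ N +_) (Σ-cong N (λ r _ → inner r)) ⟩
    n ^ N + Σ N (λ r → (N C r) * n ^ r)
      ≡⟨ +-comm (n ^ N) _ ⟩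
    Σ N (λ r → (N C r) * n ^ r) + n ^ N
      ≡⟨ cong (Σ N (λ r → (N C r) * n ^ r) +_) (sym diagonal) ⟩
    Σ N (λ r → (N C r) * n ^ r) + (N C N) * n ^ N
      ≡⟨ sym (Σ-last N (λ r → (N C r) * n ^ r)) ⟩
    binomSum N (n ^_)
      ≡⟨ binomial-theorem n N ⟩
    suc n ^ N
      ∎
    where
    diagonal : (N C N) * n ^ N ≡ n ^ N
    diagonal = trans (cong (_* n ^ N) (nCn≡1 N)) (*-identityˡ (n ^ N))
    inner : ∀ r → binomSum n (λ j → (N C r) * surj j r) ≡ (N C r) * n ^ r
    inner r = trans (binomSum-*ˡ n (N C r) (λ j → surj j r)) (cong ((N C r) *_) (surj-total n r))

  -- The same count with the empty image excluded (possible when N ≥ 1) and the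
  -- binomial sum read backwards:  Σ_{t < n} C(n,t) surj (n-t) (N+1) = n^(N+1).
  surj-total-nonempty : ∀ n N → Σ n (λ t → (n C t) * surj (n ∸ t) (suc N)) ≡ n ^ suc N
  surj-total-nonempty n N = begin
    Σ n g                              ≡⟨ sym (+-identityʳ (Σ n g)) ⟩
    Σ n g + 0                          ≡⟨ cong (Σ n g +_) (sym empty-image) ⟩
    Σ n g + g n                        ≡⟨ sym (Σ-last n g) ⟩
    Σ (suc n) g                        ≡⟨ binomSum-reflect n (λ j → surj j (suc N)) ⟩
    binomSum n (λ j → surj j (suc N))  ≡⟨ surj-total n (suc N) ⟩
    n ^ suc N                          ∎
    where
    g : ℕ → ℕ
    g t = (n C t) * surj (n ∸ t) (suc N)
    empty-image : g n ≡ 0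
    empty-image = trans (cong (λ j → (n C n) * surj j (suc N)) (n∸n≡0 n)) (*-zeroʳ (n C n))

  -- Surjections from an (n+p+1)-set onto an (n+1)-set, classified by the size
  -- n + (p - k) of the set of points not sent to the first target.
  surj-split : ∀ n p → surj (suc n) (suc (n + p))
               ≡ Σ (suc p) (λ k → (suc (n + p) C (n + (p ∸ k))) * surj n (n + (p ∸ k)))
  surj-split n p = begin
    Σ M g                                     ≡⟨ cong (λ z → Σ z g) (sym (+-suc n p)) ⟩
    Σ (n + suc p) g                           ≡⟨ Σ-split n (suc p) g ⟩
    Σ n g + Σ (suc p) (λ q → g (n + q))       ≡⟨ cong (_+ Σ (suc p) (λ q → g (n + q))) too-small ⟩
    Σ (suc p) (λ q → g (n + q))               ≡⟨ Σ-rev (suc p) (λ q → g (n + q)) ⟩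
    Σ (suc p) (λ k → g (n + (p ∸ k)))         ∎
    where
    M = suc (n + p)
    g : ℕ → ℕ
    g r = (M C r) * surj n r
    too-small : Σ n g ≡ 0
    too-small = Σ-zero n g (λ r r<n → trans (cong ((M C r) *_) (surj-vanish n r r<n)) (*-zeroʳ (M C r)))

module Fractions where
  open import Data.Nat as ℕ using (ℕ; zero; suc; _∸_; _!; _≤_; _<_; NonZero)
  import Data.Nat.Properties as ℕ
  open import Data.Nat.Combinatorics using (_C_; nCk≡n!/k![n-k]!; k![n∸k]!∣n!)
  open import Data.Nat.DivMod using (m/n*n≡m)
  open import Data.Integer as ℤ using (+_)
  import Data.Integer.Properties as ℤ
  open import Data.Rational using (ℚ; _/_; _+_; _*_; fromℚᵘ)
  open import Data.Rational.Properties
  import Data.Rational.Unnormalised as ℚᵘ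
  import Data.Rational.Unnormalised.Properties as ℚᵘ
  open import Data.List using (List; []; _∷_; map; concatMap; applyUpTo; upTo; _++_)
  open import Data.List.Properties using (map-++; map-∘)
  open import Data.List.Relation.Unary.All as All using (All; []; _∷_)
  open import Data.List.Relation.Unary.All.Properties using (concat⁺; map⁺; applyUpTo⁺₁)
  open import Data.Vec using (Vec; []; _∷_)
  import Data.Vec as Vec
  open import Relation.Binary.PropositionalEquality
  open ≡-Reasoning
  open import Data.Nat.Solver using (module +-*-Solver)
  open +-*-Solver using (solve; _:=_; con; _:+_; _:*_)

  open import Defs
  open Counting using (Σ; surj; surj-split)

  ι : ℕ → ℚ
  ι k = (+ k) / 1

  -- Arithmetic of fractions with natural numerators, computed through the
  -- unnormalised rationals, of which ℚ is a retract.
  fromℚᵘ-+ : ∀ u v → fromℚᵘ u + fromℚᵘ v ≡ fromℚᵘ (u ℚᵘ.+ v)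
  fromℚᵘ-+ u v = toℚᵘ-injective (ℚᵘ.≃-trans (toℚᵘ-homo-+ (fromℚᵘ u) (fromℚᵘ v))
    (ℚᵘ.≃-trans (ℚᵘ.+-cong (toℚᵘ-fromℚᵘ u) (toℚᵘ-fromℚᵘ v)) (ℚᵘ.≃-sym (toℚᵘ-fromℚᵘ (u ℚᵘ.+ v)))))

  fromℚᵘ-* : ∀ u v → fromℚᵘ u * fromℚᵘ v ≡ fromℚᵘ (u ℚᵘ.* v)
  fromℚᵘ-* u v = toℚᵘ-injective (ℚᵘ.≃-trans (toℚᵘ-homo-* (fromℚᵘ u) (fromℚᵘ v))
    (ℚᵘ.≃-trans (ℚᵘ.*-cong (toℚᵘ-fromℚᵘ u) (toℚᵘ-fromℚᵘ v)) (ℚᵘ.≃-sym (toℚᵘ-fromℚᵘ (u ℚᵘ.* v)))))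

  /-cross : ∀ x y d e .{{_ : NonZero d}} .{{_ : NonZero e}} →
            x ℕ.* e ≡ y ℕ.* d → (+ x) / d ≡ (+ y) / e
  /-cross x y (suc d) (suc e) eq = fromℚᵘ-cong {ℚᵘ.mkℚᵘ (+ x) d} {ℚᵘ.mkℚᵘ (+ y) e}
    (ℚᵘ.*≡* (trans (sym (ℤ.pos-* x (suc e))) (trans (cong +_ eq) (ℤ.pos-* y (suc d)))))

  /-* : ∀ x y d e .{{_ : NonZero d}} .{{_ : NonZero e}} →
        ((+ x) / d) * ((+ y) / e) ≡ ((+ (x ℕ.* y)) / (d ℕ.* e)) {{ℕ.m*n≢0 d e}}
  /-* x y (suc d) (suc e) =
    trans (fromℚᵘ-* (ℚᵘ.mkℚᵘ (+ x) d) (ℚᵘ.mkℚᵘ (+ y) e)) (cong (_/ (suc d ℕ.* suc e)) (sym (ℤ.pos-* x y)))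

  ι-+ : ∀ a b → ι a + ι b ≡ ι (a ℕ.+ b)
  ι-+ a b = trans (fromℚᵘ-+ (ℚᵘ.mkℚᵘ (+ a) 0) (ℚᵘ.mkℚᵘ (+ b) 0)) (/-cong numerators refl)
    where
    numerators : (+ a) ℤ.* (+ 1) ℤ.+ (+ b) ℤ.* (+ 1) ≡ + (a ℕ.+ b)
    numerators = trans (cong₂ ℤ._+_ (ℤ.*-identityʳ (+ a)) (ℤ.*-identityʳ (+ b))) (sym (ℤ.pos-+ a b))

  ι-* : ∀ a b → ι a * ι b ≡ ι (a ℕ.* b)
  ι-* a b = /-* a b 1 1

  C-factorials : ∀ r j → ((r ℕ.+ j) C r) ℕ.* (r ! ℕ.* j !) ≡ (r ℕ.+ j) !
  C-factorials r j = begin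
    ((r ℕ.+ j) C r) ℕ.* (r ! ℕ.* j !)  ≡⟨ cong (λ i → ((r ℕ.+ j) C r) ℕ.* (r ! ℕ.* i !)) (sym (ℕ.m+n∸m≡n r j)) ⟩
    ((r ℕ.+ j) C r) ℕ.* D              ≡⟨ cong (ℕ._* D) (nCk≡n!/k![n-k]! r≤r+j) ⟩
    (r ℕ.+ j) ! ℕ./ D ℕ.* D            ≡⟨ m/n*n≡m (k![n∸k]!∣n! r≤r+j) ⟩
    (r ℕ.+ j) !                        ∎
    where
    r≤r+j = ℕ.m≤m+n r j
    D = r ! ℕ.* (r ℕ.+ j ∸ r) !
    instance
      D≢0 : NonZero D
      D≢0 = r ℕ.!* (r ℕ.+ j ∸ r) !≢0

  -- Splitting off the first part of a composition: with R = Σ ks + n, the multinomial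
  -- coefficient is C(R + k + 1, R) (the R points outside the first fibre) times the rest.
  term-∷ : ∀ {n} k (ks : Vec ℕ n) → let R = Vec.sum ks ℕ.+ n in
           term (k ∷ ks) ≡ ι ((R ℕ.+ suc k) C R) * term ks
  term-∷ {n} k ks = sym (begin
    ι C′ * ((+ (R !)) / P)                 ≡⟨ /-* C′ (R !) 1 P ⟩
    (+ (C′ ℕ.* R !)) / (1 ℕ.* P)           ≡⟨ /-cross (C′ ℕ.* R !) (M !) (1 ℕ.* P) (suc k ! ℕ.* P) cross ⟩
    term (k ∷ ks)                          ∎)
    where
    R = Vec.sum ks ℕ.+ n
    M = k ℕ.+ Vec.sum ks ℕ.+ suc n
    C′ = (R ℕ.+ suc k) C R
    P = factProd ks
    instance
      P≢0 : NonZero P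
      P≢0 = factProd≢0 ks
      1*P≢0 : NonZero (1 ℕ.* P)
      1*P≢0 = ℕ.m*n≢0 1 P
      [k∷ks]≢0 : NonZero (suc k ! ℕ.* P)
      [k∷ks]≢0 = factProd≢0 (k ∷ ks)
    size : R ℕ.+ suc k ≡ M
    size = solve 3 (λ S n k → (S :+ n) :+ (con 1 :+ k) := k :+ S :+ (con 1 :+ n)) refl (Vec.sum ks) n k
    cross : C′ ℕ.* R ! ℕ.* (suc k ! ℕ.* P) ≡ M ! ℕ.* (1 ℕ.* P)
    cross = begin
      C′ ℕ.* R ! ℕ.* (suc k ! ℕ.* P)        ≡⟨ solve 4 (λ c r f p → c :* r :* (f :* p) := c :* (r :* f) :* p) refl C′ (R !) (suc k !) P ⟩
      C′ ℕ.* (R ! ℕ.* suc k !) ℕ.* P        ≡⟨ cong (ℕ._* P) (C-factorials R (suc k)) ⟩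
      (R ℕ.+ suc k) ! ℕ.* P                 ≡⟨ cong (λ x → x ! ℕ.* P) size ⟩
      M ! ℕ.* P                             ≡⟨ cong (M ! ℕ.*_) (sym (ℕ.*-identityˡ P)) ⟩
      M ! ℕ.* (1 ℕ.* P)                     ∎

  sumℚ-++ : ∀ xs ys → sumℚ (xs ++ ys) ≡ sumℚ xs + sumℚ ys
  sumℚ-++ []       ys = sym (+-identityˡ (sumℚ ys))
  sumℚ-++ (x ∷ xs) ys = trans (cong (λ s → x + s) (sumℚ-++ xs ys)) (sym (+-assoc x (sumℚ xs) (sumℚ ys)))

  sumℚ-concatMap : ∀ {A B : Set} (F : B → ℚ) (g : A → List B) xs →
                   sumℚ (map F (concatMap g xs)) ≡ sumℚ (map (λ x → sumℚ (map F (g x))) xs)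
  sumℚ-concatMap F g []       = refl
  sumℚ-concatMap F g (x ∷ xs) = begin
    sumℚ (map F (g x ++ concatMap g xs))                      ≡⟨ cong sumℚ (map-++ F (g x) (concatMap g xs)) ⟩
    sumℚ (map F (g x) ++ map F (concatMap g xs))              ≡⟨ sumℚ-++ (map F (g x)) _ ⟩
    sumℚ (map F (g x)) + sumℚ (map F (concatMap g xs))        ≡⟨ cong (λ s → sumℚ (map F (g x)) + s) (sumℚ-concatMap F g xs) ⟩
    sumℚ (map F (g x)) + sumℚ (map (λ y → sumℚ (map F (g y))) xs) ∎

  sumℚ-*ˡ : ∀ {A : Set} q (F : A → ℚ) xs → sumℚ (map (λ x → q * F x) xs) ≡ q * sumℚ (map F xs)
  sumℚ-*ˡ q F []       = sym (*-zeroʳ q)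
  sumℚ-*ˡ q F (x ∷ xs) = trans (cong (λ s → q * F x + s) (sumℚ-*ˡ q F xs)) (sym (*-distribˡ-+ q (F x) _))

  sumℚ-cong : ∀ {A : Set} {F G : A → ℚ} {xs} → All (λ x → F x ≡ G x) xs → sumℚ (map F xs) ≡ sumℚ (map G xs)
  sumℚ-cong []         = refl
  sumℚ-cong (eq ∷ eqs) = cong₂ _+_ eq (sumℚ-cong eqs)

  sumℚ-applyUpTo : ∀ q (h : ℕ → ℕ) (F : ℕ → ℚ) (g : ℕ → ℕ) →
                   (∀ i → i < q → F (h i) ≡ ι (g i)) → sumℚ (map F (applyUpTo h q)) ≡ ι (Σ q g)
  sumℚ-applyUpTo zero    h F g eq = refl
  sumℚ-applyUpTo (suc q) h F g eq = trans (cong₂ _+_ (eq 0 ℕ.z<s) rest) (ι-+ (g 0) (Σ q (λ i → g (suc i))))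
    where
    rest = sumℚ-applyUpTo q (λ i → h (suc i)) F (λ i → g (suc i)) (λ i i<q → eq (suc i) (ℕ.s<s i<q))

  compositions-sum : ∀ n q → All (λ ks → Vec.sum ks ≡ q) (compositions n q)
  compositions-sum zero    zero    = refl ∷ []
  compositions-sum zero    (suc q) = []
  compositions-sum (suc n) q = concat⁺ (map⁺ (applyUpTo⁺₁ (λ k → k) (suc q) (λ {k} k<1+q →
    map⁺ (All.map (λ sum≡q∸k → trans (cong (k ℕ.+_) sum≡q∸k) (ℕ.m+[n∸m]≡n (ℕ.≤-pred k<1+q)))
                  (compositions-sum n (q ∸ k))))))

  -- The paper's a_{n+1,p} counts surjections from an (n+p)-set onto an n-set: the summand
  -- for (k₁,…,kₙ) is the number of those whose fibres have sizes k₁+1, …, kₙ+1.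
  a-counts-surjections : ∀ n p → a (suc n) p ≡ ι (surj n (n ℕ.+ p))
  a-counts-surjections zero    zero    = +-identityʳ (term [])
  a-counts-surjections zero    (suc p) = refl
  a-counts-surjections (suc n) p = begin
    sumℚ (map term (concatMap rows (upTo (suc p))))                 ≡⟨ sumℚ-concatMap term rows (upTo (suc p)) ⟩
    sumℚ (map (λ k → sumℚ (map term (rows k))) (upTo (suc p)))
      ≡⟨ sumℚ-applyUpTo (suc p) (λ k → k) (λ k → sumℚ (map term (rows k))) row-count
                        (λ k k<1+p → row-sum k (ℕ.≤-pred k<1+p)) ⟩
    ι (Σ (suc p) row-count)                                         ≡⟨ cong ι (sym (surj-split n p)) ⟩
    ι (surj (suc n) M)                                              ∎
    where
    M = suc (n ℕ.+ p)
    rows : ℕ → List (Vec ℕ (suc n))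
    rows k = map (k ∷_) (compositions n (p ∸ k))
    row-count : ℕ → ℕ
    row-count k = (M C (n ℕ.+ (p ∸ k))) ℕ.* surj n (n ℕ.+ (p ∸ k))
    row-sum : ∀ k → k ≤ p → sumℚ (map term (rows k)) ≡ ι (row-count k)
    row-sum k k≤p = begin
      sumℚ (map term (map (k ∷_) comps))                 ≡⟨ cong sumℚ (sym (map-∘ comps)) ⟩
      sumℚ (map (λ ks → term (k ∷ ks)) comps)            ≡⟨ sumℚ-cong (All.map (λ {ks} → peel {ks}) (compositions-sum n (p ∸ k))) ⟩
      sumℚ (map (λ ks → ι c * term ks) comps)            ≡⟨ sumℚ-*ˡ (ι c) term comps ⟩
      ι c * a (suc n) (p ∸ k)                            ≡⟨ cong (ι c *_) (a-counts-surjections n (p ∸ k)) ⟩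
      ι c * ι (surj n (n ℕ.+ (p ∸ k)))                   ≡⟨ ι-* c _ ⟩
      ι (c ℕ.* surj n (n ℕ.+ (p ∸ k)))                   ∎
      where
      comps = compositions n (p ∸ k)
      c = M C (n ℕ.+ (p ∸ k))
      peel : ∀ {ks} → Vec.sum ks ≡ p ∸ k → term (k ∷ ks) ≡ ι c * term ks
      peel {ks} sum≡p∸k = trans (term-∷ k ks) (cong₂ (λ total rest → ι (total C rest) * term ks) total≡M rest≡)
        where
        rest≡ : Vec.sum ks ℕ.+ n ≡ n ℕ.+ (p ∸ k)
        rest≡ = trans (cong (ℕ._+ n) sum≡p∸k) (ℕ.+-comm (p ∸ k) n)
        total≡M : Vec.sum ks ℕ.+ n ℕ.+ suc k ≡ M
        total≡M = begin
          Vec.sum ks ℕ.+ n ℕ.+ suc k   ≡⟨ cong (ℕ._+ suc k) rest≡ ⟩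
          n ℕ.+ (p ∸ k) ℕ.+ suc k      ≡⟨ ℕ.+-suc (n ℕ.+ (p ∸ k)) k ⟩
          suc (n ℕ.+ (p ∸ k) ℕ.+ k)    ≡⟨ cong suc (ℕ.+-assoc n (p ∸ k) k) ⟩
          suc (n ℕ.+ (p ∸ k ℕ.+ k))    ≡⟨ cong (λ q → suc (n ℕ.+ q)) (ℕ.m∸n+n≡m k≤p) ⟩
          M                            ∎

open import Defs
open import Data.Nat using (ℕ; _≤_; _∸_; _+_; _^_)
open import Data.Nat.Combinatorics using (_C_)
open import Data.List using (map; upTo)
open import Data.Integer using (+_)
open import Data.Rational using (_*_; _/_)
open import Relation.Binary.PropositionalEquality using (_≡_; cong; sym; module ≡-Reasoning)
open import Data.Nat as ℕ using (suc; _<_; s≤s; z≤n)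
open import Data.Nat.Properties using (+-∸-assoc; +-comm; +-assoc; m∸n+n≡m; <⇒≤)
open ≡-Reasoning
open Counting using (Σ; surj; surj-total-nonempty)
open Fractions using (ι; ι-*; sumℚ-applyUpTo; a-counts-surjections)

proposition3 : (m p : ℕ) → 2 ≤ m →
    sumℚ (map (λ t → ((+ ((m ∸ 1) C t)) / 1) * a (m ∸ t) (p + t)) (upTo (m ∸ 1)))
    ≡ (+ ((m ∸ 1) ^ (m + p ∸ 1))) / 1
proposition3 (suc (suc n′)) p (s≤s (s≤s z≤n)) = begin
  sumℚ (map (λ t → ι (n C t) * a (suc n ∸ t) (p + t)) (upTo n))
    ≡⟨ sumℚ-applyUpTo n (λ t → t) (λ t → ι (n C t) * a (suc n ∸ t) (p + t)) count summand ⟩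
  ι (Σ n count)                     ≡⟨ cong ι (surj-total-nonempty n (n′ + p)) ⟩
  ι (n ^ (n + p))                   ∎
  where
  n = suc n′
  count : ℕ → ℕ
  count t = (n C t) ℕ.* surj (n ∸ t) (n + p)
  -- the t-th summand counts the maps from an (n+p)-set to an n-set missing exactly t points
  summand : ∀ t → t < n → ι (n C t) * a (suc n ∸ t) (p + t) ≡ ι (count t)
  summand t t<n = begin
    ι (n C t) * a (suc n ∸ t) (p + t)               ≡⟨ cong (λ j → ι (n C t) * a j (p + t)) (+-∸-assoc 1 t≤n) ⟩
    ι (n C t) * a (suc (n ∸ t)) (p + t)             ≡⟨ cong (ι (n C t) *_) (a-counts-surjections (n ∸ t) (p + t)) ⟩
    ι (n C t) * ι (surj (n ∸ t) (n ∸ t + (p + t)))  ≡⟨ cong (λ N → ι (n C t) * ι (surj (n ∸ t) N)) domain-size ⟩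
    ι (n C t) * ι (surj (n ∸ t) (n + p))            ≡⟨ ι-* (n C t) (surj (n ∸ t) (n + p)) ⟩
    ι (count t)                                     ∎
    where
    t≤n = <⇒≤ t<n
    domain-size : n ∸ t + (p + t) ≡ n + p
    domain-size = begin
      n ∸ t + (p + t)  ≡⟨ cong (λ s → n ∸ t + s) (+-comm p t) ⟩
      n ∸ t + (t + p)  ≡⟨ sym (+-assoc (n ∸ t) t p) ⟩
      n ∸ t + t + p    ≡⟨ cong (_+ p) (m∸n+n≡m t≤n) ⟩
      n + p            ∎
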